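{- Let $F_q$ be a finite field and let $A$ be an $n\times n$ matrix over $F_q$. Then the number of $n\times n$ matrices $B$ over $F_q$ such that $AB=BA=0$ is equal to $q^{m^2}$, where $m$ is the number of Jordan blocks of $A$ with eigenvalue $0$. -}

module Defs where

open import Level using (Level; _⊔_)
open import Data.Nat as ℕ using (ℕ; zero; suc)
open import Data.Fin as Fin using (Fin; zero; suc; toℕ; splitAt)
open import Data.Fin.Properties using (all?)
open import Data.Sum using (inj₁; inj₂)
open import Data.Product using (Σ; _×_; _,_; ∃)
open import Data.List as List using (List; []; _∷_; length; filter; concatMap)
open import Data.List.Relation.Unary.Any using (Any)
open import Data.List.Relation.Unary.AllPairs using (AllPairs)
open import Data.Vec as Vec using (Vec)
open import Relation.Nullary using (¬_; Dec; yes; no)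
open import Relation.Nullary.Decidable using (_×-dec_)
open import Relation.Binary.PropositionalEquality using (_≡_)
open import Relation.Binary.Definitions using (Decidable)
open import Algebra.Bundles using (CommutativeRing)

-- Equality is decidable (automatic for a
-- finite field, but stated explicitly so that counting is computable).
-- Finiteness: an explicit duplicate-free complete enumeration of the
-- carrier; q is its length.
record FiniteField (c ℓ : Level) : Set (Level.suc (c ⊔ ℓ)) where
  field
    commRing  : CommutativeRing c ℓ
  open CommutativeRing commRing public
  field
    _≟_       : Decidable _≈_
    0≉1       : ¬ (0# ≈ 1#)
    inverse   : ∀ x → ¬ (x ≈ 0#) → ∃ λ y → x * y ≈ 1#
    elements  : List Carrier
    complete  : ∀ x → Any (x ≈_) elements
    distinct  : AllPairs (λ x y → ¬ (x ≈ y)) elements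

  order : ℕ
  order = length elements

allFuns : ∀ {a} {A : Set a} (n : ℕ) → List A → List (Fin n → A)
allFuns zero    xs = (λ ()) ∷ []
allFuns (suc n) xs =
  concatMap (λ x → List.map (λ f → cons x f) (allFuns n xs)) xs
  where
  cons : _ → (Fin n → _) → Fin (suc n) → _
  cons x f zero    = x
  cons x f (suc i) = f i

module Matrices {c ℓ} (F : FiniteField c ℓ) where
  open FiniteField F

  Mat : ℕ → ℕ → Set c
  Mat r s = Fin r → Fin s → Carrier

  infix 4 _≈ᴹ_
  infixl 7 _·_
  infixr 6 _⊕_

  _≈ᴹ_ : ∀ {r s} → Mat r s → Mat r s → Set ℓ
  M ≈ᴹ N = ∀ i j → M i j ≈ N i j

  _≟ᴹ_ : ∀ {r s} (M N : Mat r s) → Dec (M ≈ᴹ N)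
  M ≟ᴹ N = all? (λ i → all? (λ j → M i j ≟ N i j))

  ∑ : ∀ {k} → (Fin k → Carrier) → Carrier
  ∑ {ℕ.zero}  f = 0#
  ∑ {ℕ.suc k} f = f Fin.zero + ∑ (λ i → f (Fin.suc i))

  _·_ : ∀ {r s t} → Mat r s → Mat s t → Mat r t
  (M · N) i k = ∑ (λ j → M i j * N j k)

  𝟘 : ∀ {r s} → Mat r s
  𝟘 _ _ = 0#

  δ : ℕ → ℕ → Carrier
  δ i j with i ℕ.≟ j
  ... | yes _ = 1#
  ... | no  _ = 0#

  𝟙 : ∀ {r} → Mat r r
  𝟙 i j = δ (toℕ i) (toℕ j)

  Invertible : ∀ {r} → Mat r r → Set (c ⊔ ℓ)
  Invertible {r} M = Σ (Mat r r) λ N → (M · N ≈ᴹ 𝟙) × (N · M ≈ᴹ 𝟙)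

  _⊕_ : ∀ {a b} → Mat a a → Mat b b → Mat (a ℕ.+ b) (a ℕ.+ b)
  _⊕_ {a} M N i j with splitAt a i | splitAt a j
  ... | inj₁ i′ | inj₁ j′ = M i′ j′
  ... | inj₂ i′ | inj₂ j′ = N i′ j′
  ... | _       | _       = 0#

  jordan0 : (k : ℕ) → Mat k k
  jordan0 k i j = δ (suc (toℕ i)) (toℕ j)

  -- total size of blocks of sizes b₁+1, …, bₘ+1 (all sizes ≥ 1)
  blocksSize : ∀ {m} → Vec ℕ m → ℕ
  blocksSize Vec.[]       = 0
  blocksSize (b Vec.∷ bs) = suc b ℕ.+ blocksSize bs

  jordanNil : ∀ {m} (bs : Vec ℕ m) → Mat (blocksSize bs) (blocksSize bs)
  jordanNil Vec.[]       = λ ()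
  jordanNil (b Vec.∷ bs) = jordan0 (suc b) ⊕ jordanNil bs

  -- "A has exactly m Jordan blocks with eigenvalue 0":
  -- A is similar (over F) to diag(J_{k₁}(0), …, J_{kₘ}(0), C) with C
  -- invertible (all eigenvalues of C are nonzero).
  record ZeroJordanBlocks {n} (A : Mat n n) (m : ℕ) : Set (c ⊔ ℓ) where
    field
      sizes   : Vec ℕ m
      l       : ℕ
      C       : Mat l l
      C-inv   : Invertible C
      P       : Mat n (blocksSize sizes ℕ.+ l)
      Q       : Mat (blocksSize sizes ℕ.+ l) n
      QP≈1    : Q · P ≈ᴹ 𝟙
      PQ≈1    : P · Q ≈ᴹ 𝟙
      similar : (Q · A) · P ≈ᴹ (jordanNil sizes ⊕ C)

  allMats : (n : ℕ) → List (Mat n n)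
  allMats n = allFuns n (allFuns n elements)

  annihilatorCount : ∀ {n} → Mat n n → ℕ
  annihilatorCount {n} A =
    length (filter (λ B → ((A · B) ≟ᴹ 𝟘) ×-dec ((B · A) ≟ᴹ 𝟘)) (allMats n))

{-# OPTIONS --safe #-}
module Submission where

-- Conjugating by the similarity, it suffices to treat D = diag(J, C) with J
-- nilpotent in Jordan form with m blocks and C invertible.  The columns of D
-- at the first index of each block vanish, and every other standard row
-- vector is a row of L · D for L = diag(Jᵀ, C⁻¹); hence D · Y = 0 exactly
-- when Y vanishes outside these m rows.  Transposing, Y · D = 0 exactly when
-- Y vanishes outside the m columns at the last index of a block.  So the
-- two-sided annihilator of D consists of the matrices supported on an m × m
-- grid of positions, of which there are q^(m²).

open import Defs
open import Level using (Level; _⊔_)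
open import Data.Nat as ℕ using (ℕ; zero; suc)
import Data.Nat.Properties as ℕ
open import Data.Fin as Fin using (Fin; zero; suc; toℕ; _↑ˡ_; _↑ʳ_)
open import Data.Fin.Properties
  using ( injective⇒≤; toℕ-injective; splitAt-↑ˡ; splitAt-↑ʳ; ↑ˡ-injective; ↑ʳ-injective
        ; toℕ-inject₁; toℕ-fromℕ; toℕ<n; fromℕ≢inject₁ )
open import Data.Fin.Relation.Unary.Top using (view; ‵fromℕ; ‵inject₁)
open import Data.Product using (∃; _×_; _,_; proj₁; proj₂)
import Data.Sum as Sum
open import Data.List as List using (List; []; _∷_; length; filter; concatMap; cartesianProductWith)
open import Data.List.Properties using (length-++; length-map)
import Data.List.Relation.Unary.All as All
import Data.List.Relation.Unary.AllPairs as AllPairs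
open import Data.List.Relation.Unary.Any using (here; index)
open import Data.List.Relation.Unary.Any.Properties using (lookup-index)
open import Data.List.Relation.Unary.Enumerates.Setoid using (IsEnumeration)
open import Data.List.Relation.Unary.Unique.Setoid using (Unique)
open import Data.List.Relation.Unary.Unique.Setoid.Properties using (cartesianProductWith⁺; filter⁺)
open import Data.List.Membership.Propositional.Properties using (∈-lookup)
import Data.List.Membership.Setoid as SetoidMembership
open import Data.List.Membership.Setoid.Properties
  using (∈-cartesianProductWith⁺; ∈-resp-≈; ∈-filter⁺; ∈-filter⁻)
  renaming (∈-lookup to ∈ₛ-lookup)
open import Data.Vec using (Vec; []; _∷_)
import Data.Vec.Functional.Relation.Binary.Equality.Setoid as VecEquality
open import Function using (_∘_; flip)
open import Relation.Nullary using (¬_; Dec; yes; no; contradiction)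
import Relation.Nullary.Decidable as Dec
open import Relation.Nullary.Decidable using (_×-dec_)
open import Relation.Binary.Bundles using (Setoid)
open import Relation.Binary.PropositionalEquality as ≡ using (_≡_; _≢_)

data SplitView (a b : ℕ) : Fin (a ℕ.+ b) → Set where
  inˡ : (i : Fin a) → SplitView a b (i ↑ˡ b)
  inʳ : (j : Fin b) → SplitView a b (a ↑ʳ j)

splitView : ∀ a b k → SplitView a b k
splitView zero    b k       = inʳ k
splitView (suc a) b zero    = inˡ zero
splitView (suc a) b (suc k) with splitView a b k
... | inˡ i = inˡ (suc i)
... | inʳ j = inʳ j

↑ˡ≢↑ʳ : ∀ {a b} (i : Fin a) (j : Fin b) → i ↑ˡ b ≢ a ↑ʳ j
↑ˡ≢↑ʳ {a} {b} i j eq with () ← ≡.trans (≡.sym (splitAt-↑ˡ a i b))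
                                  (≡.trans (≡.cong (Fin.splitAt a) eq) (splitAt-↑ʳ a b j))

module _ {a b c} {A : Set a} {B : Set b} {C : Set c} (f : A → B → C) where
  concatMap-map : ∀ xs ys → concatMap (λ x → List.map (f x) ys) xs ≡ cartesianProductWith f xs ys
  concatMap-map []       ys = ≡.refl
  concatMap-map (x ∷ xs) ys = ≡.cong (List.map (f x) ys List.++_) (concatMap-map xs ys)

  length-cartesianProductWith : ∀ xs ys →
                                length (cartesianProductWith f xs ys) ≡ length xs ℕ.* length ys
  length-cartesianProductWith []       ys = ≡.refl
  length-cartesianProductWith (x ∷ xs) ys = ≡.trans (length-++ (List.map (f x) ys))
    (≡.cong₂ ℕ._+_ (length-map (f x) ys) (length-cartesianProductWith xs ys))

-- In the successor case the underscores below stand for the function local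
-- to allFuns that prepends a head to a tail.

length-allFuns : ∀ {a} {A : Set a} n (xs : List A) → length (allFuns n xs) ≡ length xs ℕ.^ n
length-allFuns zero    xs = ≡.refl
length-allFuns (suc n) xs = begin
  length (allFuns (suc n) xs)                        ≡⟨ ≡.cong length (concatMap-map _ xs (allFuns n xs)) ⟩
  length (cartesianProductWith _ xs (allFuns n xs))  ≡⟨ length-cartesianProductWith _ xs (allFuns n xs) ⟩
  length xs ℕ.* length (allFuns n xs)                ≡⟨ ≡.cong (length xs ℕ.*_) (length-allFuns n xs) ⟩
  length xs ℕ.^ suc n                                ∎
  where open ≡.≡-Reasoning

module _ {a ℓ} (S : Setoid a ℓ) where
  open Setoid S
  open VecEquality S using (≋-setoid)
  open SetoidMembership using (_∈_)

  allFuns-unique : ∀ n {xs} → Unique S xs → Unique (≋-setoid n) (allFuns n xs)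
  allFuns-unique zero    _          = All.[] AllPairs.∷ AllPairs.[]
  allFuns-unique (suc n) {xs} xs! =
    ≡.subst (Unique (≋-setoid (suc n))) (≡.sym (concatMap-map _ xs (allFuns n xs)))
      (cartesianProductWith⁺ S (≋-setoid n) (≋-setoid (suc n)) _ (λ eq → eq zero , eq ∘ suc)
        xs! (allFuns-unique n xs!))

  allFuns-enumerates : ∀ n {xs} → IsEnumeration S xs → IsEnumeration (≋-setoid n) (allFuns n xs)
  allFuns-enumerates zero    _            f = here λ ()
  allFuns-enumerates (suc n) {xs} xs-all f =
    ≡.subst (_∈_ (≋-setoid (suc n)) f) (≡.sym (concatMap-map _ xs (allFuns n xs)))
      (∈-resp-≈ (≋-setoid (suc n)) (λ { zero → refl ; (suc i) → refl })
        (∈-cartesianProductWith⁺ S (≋-setoid n) (≋-setoid (suc n))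
          (λ { x≈y _ zero → x≈y ; _ f≋g (suc i) → f≋g i })
          (xs-all (f zero)) (allFuns-enumerates n xs-all (f ∘ suc))))

  unique-lookup-injective : ∀ {xs} → Unique S xs → ∀ {i j} →
                            List.lookup xs i ≈ List.lookup xs j → i ≡ j
  unique-lookup-injective (x≉xs AllPairs.∷ xs!) {zero}  {zero}  _  = ≡.refl
  unique-lookup-injective (x≉xs AllPairs.∷ xs!) {zero}  {suc j} eq =
    contradiction eq (All.lookup x≉xs (∈-lookup j))
  unique-lookup-injective (x≉xs AllPairs.∷ xs!) {suc i} {zero}  eq =
    contradiction (sym eq) (All.lookup x≉xs (∈-lookup i))
  unique-lookup-injective (x≉xs AllPairs.∷ xs!) {suc i} {suc j} eq =
    ≡.cong suc (unique-lookup-injective xs! eq)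

module _ {a b ℓ₁ ℓ₂} (S : Setoid a ℓ₁) (T : Setoid b ℓ₂) where
  open Setoid S using () renaming (Carrier to A; _≈_ to _≈₁_)
  open Setoid T using () renaming (Carrier to B; _≈_ to _≈₂_)
  open SetoidMembership S using () renaming (_∈_ to _∈₁_)
  open SetoidMembership T using () renaming (_∈_ to _∈₂_)

  length-≤-injection : ∀ {xs ys} (f : A → B) → Unique S xs → (∀ {x} → x ∈₁ xs → f x ∈₂ ys) →
                       (∀ {x y} → x ∈₁ xs → y ∈₁ xs → f x ≈₂ f y → x ≈₁ y) →
                       length xs ℕ.≤ length ys
  length-≤-injection {xs} {ys} f xs! f∈ys f-injective = injective⇒≤ position-injective
    where
    open import Relation.Binary.Reasoning.Setoid T

    xs∋ : ∀ i → List.lookup xs i ∈₁ xs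
    xs∋ = ∈ₛ-lookup S xs

    position : Fin (length xs) → Fin (length ys)
    position i = index (f∈ys (xs∋ i))

    position-injective : ∀ {i j} → position i ≡ position j → i ≡ j
    position-injective {i} {j} eq =
      unique-lookup-injective S xs! (f-injective (xs∋ i) (xs∋ j) (begin
        f (List.lookup xs i)         ≈⟨ lookup-index (f∈ys (xs∋ i)) ⟩
        List.lookup ys (position i)  ≡⟨ ≡.cong (List.lookup ys) eq ⟩
        List.lookup ys (position j)  ≈⟨ lookup-index (f∈ys (xs∋ j)) ⟨
        f (List.lookup xs j)         ∎))

module _ {c ℓ} (F : FiniteField c ℓ) where
  open FiniteField F hiding (zero)
  open Matrices F
  open import Algebra.Properties.Semiring.Sum semiring using (sum; sum-cong-≗; ∑-comm)

  δ-≡ : ∀ {a b} → a ≡ b → δ a b ≡ 1#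
  δ-≡ {a} {b} a≡b with a ℕ.≟ b
  ... | yes _   = ≡.refl
  ... | no  a≢b = contradiction a≡b a≢b

  δ-≢ : ∀ {a b} → a ≢ b → δ a b ≡ 0#
  δ-≢ {a} {b} a≢b with a ℕ.≟ b
  ... | yes a≡b = contradiction a≡b a≢b
  ... | no  _   = ≡.refl

  δ-suc : ∀ a b → δ (suc a) (suc b) ≡ δ a b
  δ-suc a b with a ℕ.≟ b
  ... | yes a≡b = δ-≡ (≡.cong suc a≡b)
  ... | no  a≢b = δ-≢ (a≢b ∘ ℕ.suc-injective)

  δ-sym : ∀ a b → δ a b ≡ δ b a
  δ-sym a b with a ℕ.≟ b
  ... | yes a≡b = ≡.sym (δ-≡ (≡.sym a≡b))
  ... | no  a≢b = ≡.sym (δ-≢ (a≢b ∘ ≡.sym))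

  ∑-cong : ∀ {k} {f g : Fin k → Carrier} → (∀ i → f i ≈ g i) → ∑ f ≈ ∑ g
  ∑-cong {zero}  f≈g = refl
  ∑-cong {suc k} f≈g = +-cong (f≈g zero) (∑-cong (f≈g ∘ suc))

  ∑-zero : ∀ {k} {f : Fin k → Carrier} → (∀ i → f i ≈ 0#) → ∑ f ≈ 0#
  ∑-zero {zero}  f≈0 = refl
  ∑-zero {suc k} f≈0 = trans (+-cong (f≈0 zero) (∑-zero (f≈0 ∘ suc))) (+-identityʳ 0#)

  *-distribˡ-∑ : ∀ {k} x (f : Fin k → Carrier) → x * ∑ f ≈ ∑ (λ i → x * f i)
  *-distribˡ-∑ {zero}  x f = zeroʳ x
  *-distribˡ-∑ {suc k} x f = trans (distribˡ x _ _) (+-congˡ (*-distribˡ-∑ x (f ∘ suc)))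

  *-distribʳ-∑ : ∀ {k} x (f : Fin k → Carrier) → ∑ f * x ≈ ∑ (λ i → f i * x)
  *-distribʳ-∑ {zero}  x f = zeroˡ x
  *-distribʳ-∑ {suc k} x f = trans (distribʳ x _ _) (+-congˡ (*-distribʳ-∑ x (f ∘ suc)))

  ∑≡sum : ∀ {k} (f : Fin k → Carrier) → ∑ f ≡ sum f
  ∑≡sum {zero}  f = ≡.refl
  ∑≡sum {suc k} f = ≡.cong (f zero +_) (∑≡sum (f ∘ suc))

  ∑-swap : ∀ {a b} (f : Fin a → Fin b → Carrier) →
           ∑ (λ i → ∑ (f i)) ≈ ∑ (λ j → ∑ (λ i → f i j))
  ∑-swap f = begin
    ∑ (λ i → ∑ (f i))              ≡⟨ ∑∑≡sumsum f ⟩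
    sum (λ i → sum (f i))          ≈⟨ ∑-comm f ⟩
    sum (λ j → sum (λ i → f i j))  ≡⟨ ∑∑≡sumsum (flip f) ⟨
    ∑ (λ j → ∑ (λ i → f i j))      ∎
    where
    open import Relation.Binary.Reasoning.Setoid setoid

    ∑∑≡sumsum : ∀ {a b} (g : Fin a → Fin b → Carrier) →
                ∑ (λ i → ∑ (g i)) ≡ sum (λ i → sum (g i))
    ∑∑≡sumsum g = ≡.trans (∑≡sum (λ i → ∑ (g i))) (sum-cong-≗ (∑≡sum ∘ g))

  ∑-↑ : ∀ a {b} (f : Fin (a ℕ.+ b) → Carrier) →
        ∑ f ≈ ∑ (λ i → f (i ↑ˡ b)) + ∑ (λ j → f (a ↑ʳ j))
  ∑-↑ zero    f = sym (+-identityˡ _)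
  ∑-↑ (suc a) f = trans (+-congˡ (∑-↑ a (f ∘ suc))) (sym (+-assoc _ _ _))

  ∑-𝟙ˡ : ∀ {k} (i : Fin k) (f : Fin k → Carrier) → ∑ (λ j → 𝟙 i j * f j) ≈ f i
  ∑-𝟙ˡ zero    f = trans (+-cong (*-identityˡ (f zero)) (∑-zero λ j → zeroˡ (f (suc j))))
                         (+-identityʳ (f zero))
  ∑-𝟙ˡ (suc i) f = trans (+-cong (zeroˡ (f zero)) (∑-cong 𝟙-suc))
                         (trans (+-identityˡ _) (∑-𝟙ˡ i (f ∘ suc)))
    where
    𝟙-suc : ∀ j → 𝟙 (suc i) (suc j) * f (suc j) ≈ 𝟙 i j * f (suc j)
    𝟙-suc j = *-congʳ (reflexive (δ-suc (toℕ i) (toℕ j)))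

  ∑-𝟙ʳ : ∀ {k} (j : Fin k) (f : Fin k → Carrier) → ∑ (λ i → f i * 𝟙 i j) ≈ f j
  ∑-𝟙ʳ j f = trans (∑-cong λ i → trans (*-comm (f i) _) (*-congʳ (reflexive (δ-sym (toℕ i) (toℕ j)))))
                   (∑-𝟙ˡ j f)

  matSetoid : ℕ → ℕ → Setoid c ℓ
  matSetoid r s = VecEquality.≋-setoid (VecEquality.≋-setoid setoid s) r

  module _ {r s : ℕ} where
    open Setoid (matSetoid r s) public
      using () renaming (refl to ≈ᴹ-refl; sym to ≈ᴹ-sym; trans to ≈ᴹ-trans)

  _ᵀ : ∀ {r s} → Mat r s → Mat s r
  (M ᵀ) i j = M j i

  ·-cong : ∀ {r s t} {M M′ : Mat r s} {N N′ : Mat s t} →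
           M ≈ᴹ M′ → N ≈ᴹ N′ → M · N ≈ᴹ M′ · N′
  ·-cong M≈M′ N≈N′ i k = ∑-cong (λ j → *-cong (M≈M′ i j) (N≈N′ j k))

  ·-congˡ : ∀ {r s t} (M : Mat r s) {N N′ : Mat s t} → N ≈ᴹ N′ → M · N ≈ᴹ M · N′
  ·-congˡ M = ·-cong ≈ᴹ-refl

  ·-congʳ : ∀ {r s t} (N : Mat s t) {M M′ : Mat r s} → M ≈ᴹ M′ → M · N ≈ᴹ M′ · N
  ·-congʳ N M≈M′ = ·-cong M≈M′ ≈ᴹ-refl

  ·-cong-row : ∀ {r s t} {M M′ : Mat r s} (N : Mat s t) {i} → (∀ j → M i j ≈ M′ i j) →
               ∀ k → (M · N) i k ≈ (M′ · N) i k
  ·-cong-row N Mᵢ≈M′ᵢ k = ∑-cong (λ j → *-congʳ (Mᵢ≈M′ᵢ j))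

  ·-assoc : ∀ {r s t u} (M : Mat r s) (N : Mat s t) (O : Mat t u) → (M · N) · O ≈ᴹ M · (N · O)
  ·-assoc M N O i l = begin
    ∑ (λ k → ∑ (λ j → M i j * N j k) * O k l)
      ≈⟨ ∑-cong (λ k → *-distribʳ-∑ (O k l) (λ j → M i j * N j k)) ⟩
    ∑ (λ k → ∑ (λ j → M i j * N j k * O k l))
      ≈⟨ ∑-swap (λ k j → M i j * N j k * O k l) ⟩
    ∑ (λ j → ∑ (λ k → M i j * N j k * O k l))
      ≈⟨ ∑-cong (λ j → ∑-cong (λ k → *-assoc (M i j) (N j k) (O k l))) ⟩
    ∑ (λ j → ∑ (λ k → M i j * (N j k * O k l)))
      ≈⟨ ∑-cong (λ j → *-distribˡ-∑ (M i j) (λ k → N j k * O k l)) ⟨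
    ∑ (λ j → M i j * ∑ (λ k → N j k * O k l))
      ∎
    where open import Relation.Binary.Reasoning.Setoid setoid

  ·-zeroˡ : ∀ {r s t} (M : Mat s t) → 𝟘 {r} · M ≈ᴹ 𝟘
  ·-zeroˡ M i k = ∑-zero (λ j → zeroˡ (M j k))

  ·-zeroʳ : ∀ {r s t} (M : Mat r s) → M · 𝟘 {s} {t} ≈ᴹ 𝟘
  ·-zeroʳ M i k = ∑-zero (λ j → zeroʳ (M i j))

  ·-identityˡ : ∀ {r s} (M : Mat r s) → 𝟙 · M ≈ᴹ M
  ·-identityˡ M i j = ∑-𝟙ˡ i (λ k → M k j)

  ·-identityʳ : ∀ {r s} (M : Mat r s) → M · 𝟙 ≈ᴹ M
  ·-identityʳ M i j = ∑-𝟙ʳ j (M i)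

  ·-ᵀ : ∀ {r s t} (M : Mat r s) (N : Mat s t) → (M · N) ᵀ ≈ᴹ N ᵀ · M ᵀ
  ·-ᵀ M N k i = ∑-cong (λ j → *-comm (M i j) (N j k))

  ·≈𝟘⇒ᵀ·ᵀ≈𝟘 : ∀ {r s t} {M : Mat r s} {N : Mat s t} → M · N ≈ᴹ 𝟘 → N ᵀ · M ᵀ ≈ᴹ 𝟘
  ·≈𝟘⇒ᵀ·ᵀ≈𝟘 {M = M} {N} MN≈𝟘 k i = trans (sym (·-ᵀ M N k i)) (MN≈𝟘 i k)

  𝟙-≡ : ∀ {r} {i j : Fin r} → i ≡ j → 𝟙 i j ≡ 1#
  𝟙-≡ = δ-≡ ∘ ≡.cong toℕ

  𝟙-≢ : ∀ {r} {i j : Fin r} → i ≢ j → 𝟙 i j ≡ 0#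
  𝟙-≢ i≢j = δ-≢ (i≢j ∘ toℕ-injective)

  𝟙-injective : ∀ {r s} (f : Fin r → Fin s) → (∀ i j → f i ≡ f j → i ≡ j) →
                ∀ i j → 𝟙 (f i) (f j) ≡ 𝟙 i j
  𝟙-injective f f-injective i j with i Fin.≟ j
  ... | yes i≡j = ≡.trans (𝟙-≡ (≡.cong f i≡j)) (≡.sym (𝟙-≡ i≡j))
  ... | no  i≢j = ≡.trans (𝟙-≢ (i≢j ∘ f-injective i j)) (≡.sym (𝟙-≢ i≢j))

  module _ {a b} (M : Mat a a) (N : Mat b b) where
    ⊕-ˡˡ : ∀ i j → (M ⊕ N) (i ↑ˡ b) (j ↑ˡ b) ≡ M i j
    ⊕-ˡˡ i j rewrite splitAt-↑ˡ a i b | splitAt-↑ˡ a j b = ≡.refl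

    ⊕-ˡʳ : ∀ i j → (M ⊕ N) (i ↑ˡ b) (a ↑ʳ j) ≡ 0#
    ⊕-ˡʳ i j rewrite splitAt-↑ˡ a i b | splitAt-↑ʳ a b j = ≡.refl

    ⊕-ʳˡ : ∀ i j → (M ⊕ N) (a ↑ʳ i) (j ↑ˡ b) ≡ 0#
    ⊕-ʳˡ i j rewrite splitAt-↑ʳ a b i | splitAt-↑ˡ a j b = ≡.refl

    ⊕-ʳʳ : ∀ i j → (M ⊕ N) (a ↑ʳ i) (a ↑ʳ j) ≡ N i j
    ⊕-ʳʳ i j rewrite splitAt-↑ʳ a b i | splitAt-↑ʳ a b j = ≡.refl

    ⊕-·-rowˡ : ∀ {t} (Y : Mat (a ℕ.+ b) t) i k →
               ((M ⊕ N) · Y) (i ↑ˡ b) k ≈ (M · (Y ∘ (_↑ˡ b))) i k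
    ⊕-·-rowˡ Y i k = trans (∑-↑ a _) (trans
      (+-cong (∑-cong λ j → *-congʳ (reflexive (⊕-ˡˡ i j)))
              (∑-zero λ j → trans (*-congʳ (reflexive (⊕-ˡʳ i j))) (zeroˡ _)))
      (+-identityʳ _))

    ⊕-·-rowʳ : ∀ {t} (Y : Mat (a ℕ.+ b) t) i k →
               ((M ⊕ N) · Y) (a ↑ʳ i) k ≈ (N · (Y ∘ (a ↑ʳ_))) i k
    ⊕-·-rowʳ Y i k = trans (∑-↑ a _) (trans
      (+-cong (∑-zero λ j → trans (*-congʳ (reflexive (⊕-ʳˡ i j))) (zeroˡ _))
              (∑-cong λ j → *-congʳ (reflexive (⊕-ʳʳ i j))))
      (+-identityˡ _))

  ⊕-ᵀ : ∀ {a b} (M : Mat a a) (N : Mat b b) → (M ⊕ N) ᵀ ≈ᴹ M ᵀ ⊕ N ᵀ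
  ⊕-ᵀ {a} {b} M N i j with splitView a b i | splitView a b j
  ... | inˡ i | inˡ j = reflexive (≡.trans (⊕-ˡˡ M N j i) (≡.sym (⊕-ˡˡ (M ᵀ) (N ᵀ) i j)))
  ... | inˡ i | inʳ j = reflexive (≡.trans (⊕-ʳˡ M N j i) (≡.sym (⊕-ˡʳ (M ᵀ) (N ᵀ) i j)))
  ... | inʳ i | inˡ j = reflexive (≡.trans (⊕-ˡʳ M N j i) (≡.sym (⊕-ʳˡ (M ᵀ) (N ᵀ) i j)))
  ... | inʳ i | inʳ j = reflexive (≡.trans (⊕-ʳʳ M N j i) (≡.sym (⊕-ʳʳ (M ᵀ) (N ᵀ) i j)))

  ⊕-· : ∀ {a b} (M M′ : Mat a a) (N N′ : Mat b b) →
        (M ⊕ N) · (M′ ⊕ N′) ≈ᴹ (M · M′) ⊕ (N · N′)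
  ⊕-· {a} {b} M M′ N N′ i k with splitView a b i | splitView a b k
  ... | inˡ i | inˡ k = trans (⊕-·-rowˡ M N (M′ ⊕ N′) i (k ↑ˡ b)) (trans
    (∑-cong λ j → *-congˡ (reflexive (⊕-ˡˡ M′ N′ j k)))
    (reflexive (≡.sym (⊕-ˡˡ (M · M′) (N · N′) i k))))
  ... | inˡ i | inʳ k = trans (⊕-·-rowˡ M N (M′ ⊕ N′) i (a ↑ʳ k)) (trans
    (∑-zero λ j → trans (*-congˡ (reflexive (⊕-ˡʳ M′ N′ j k))) (zeroʳ _))
    (reflexive (≡.sym (⊕-ˡʳ (M · M′) (N · N′) i k))))
  ... | inʳ i | inˡ k = trans (⊕-·-rowʳ M N (M′ ⊕ N′) i (k ↑ˡ b)) (trans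
    (∑-zero λ j → trans (*-congˡ (reflexive (⊕-ʳˡ M′ N′ j k))) (zeroʳ _))
    (reflexive (≡.sym (⊕-ʳˡ (M · M′) (N · N′) i k))))
  ... | inʳ i | inʳ k = trans (⊕-·-rowʳ M N (M′ ⊕ N′) i (a ↑ʳ k)) (trans
    (∑-cong λ j → *-congˡ (reflexive (⊕-ʳʳ M′ N′ j k)))
    (reflexive (≡.sym (⊕-ʳʳ (M · M′) (N · N′) i k))))

  ⊕-cong-rowˡ : ∀ {a b} (M M′ : Mat a a) (N N′ : Mat b b) {i} → (∀ j → M i j ≈ M′ i j) →
                ∀ k → (M ⊕ N) (i ↑ˡ b) k ≈ (M′ ⊕ N′) (i ↑ˡ b) k
  ⊕-cong-rowˡ {a} {b} M M′ N N′ {i} Mᵢ≈M′ᵢ k with splitView a b k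
  ... | inˡ j = trans (reflexive (⊕-ˡˡ M N i j))
                      (trans (Mᵢ≈M′ᵢ j) (reflexive (≡.sym (⊕-ˡˡ M′ N′ i j))))
  ... | inʳ j = reflexive (≡.trans (⊕-ˡʳ M N i j) (≡.sym (⊕-ˡʳ M′ N′ i j)))

  ⊕-cong-rowʳ : ∀ {a b} (M M′ : Mat a a) (N N′ : Mat b b) {i} → (∀ j → N i j ≈ N′ i j) →
                ∀ k → (M ⊕ N) (a ↑ʳ i) k ≈ (M′ ⊕ N′) (a ↑ʳ i) k
  ⊕-cong-rowʳ {a} {b} M M′ N N′ {i} Nᵢ≈N′ᵢ k with splitView a b k
  ... | inˡ j = reflexive (≡.trans (⊕-ʳˡ M N i j) (≡.sym (⊕-ʳˡ M′ N′ i j)))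
  ... | inʳ j = trans (reflexive (⊕-ʳʳ M N i j))
                      (trans (Nᵢ≈N′ᵢ j) (reflexive (≡.sym (⊕-ʳʳ M′ N′ i j))))

  𝟙-⊕ : ∀ {a b} → 𝟙 ≈ᴹ 𝟙 {a} ⊕ 𝟙 {b}
  𝟙-⊕ {a} {b} i j with splitView a b i | splitView a b j
  ... | inˡ i | inˡ j = reflexive (≡.trans (𝟙-injective (_↑ˡ b) (↑ˡ-injective b) i j)
                                           (≡.sym (⊕-ˡˡ (𝟙 {a}) (𝟙 {b}) i j)))
  ... | inˡ i | inʳ j = reflexive (≡.trans (𝟙-≢ (↑ˡ≢↑ʳ i j)) (≡.sym (⊕-ˡʳ (𝟙 {a}) (𝟙 {b}) i j)))
  ... | inʳ i | inˡ j = reflexive (≡.trans (𝟙-≢ (↑ˡ≢↑ʳ j i ∘ ≡.sym)) (≡.sym (⊕-ʳˡ (𝟙 {a}) (𝟙 {b}) i j)))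
  ... | inʳ i | inʳ j = reflexive (≡.trans (𝟙-injective (a ↑ʳ_) (↑ʳ-injective a) i j)
                                           (≡.sym (⊕-ʳʳ (𝟙 {a}) (𝟙 {b}) i j)))

  -- For a nilpotent Jordan matrix the coordinates are the first indices of
  -- its blocks and the left inverse is its transpose.
  record KernelCoordinates {n} (D : Mat n n) (m : ℕ) : Set (c ⊔ ℓ) where
    field
      coord           : Fin m → Fin n
      coord-injective : ∀ {a b} → coord a ≡ coord b → a ≡ b
      coord?          : ∀ k → Dec (∃ λ a → coord a ≡ k)
      column-zero     : ∀ i a → D i (coord a) ≈ 0#
      leftInverse     : Mat n n
      leftInverse-row : ∀ {k} → ¬ (∃ λ a → coord a ≡ k) → ∀ j → (leftInverse · D) k j ≈ 𝟙 k j

  kernelCoordinates-resp : ∀ {n m} {D D′ : Mat n n} → D ≈ᴹ D′ →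
                           KernelCoordinates D m → KernelCoordinates D′ m
  kernelCoordinates-resp D≈D′ K = record
    { KernelCoordinates K hiding (column-zero; leftInverse-row)
    ; column-zero     = λ i a → trans (sym (D≈D′ i (coord a))) (column-zero i a)
    ; leftInverse-row = λ k∉ j → trans (·-congˡ leftInverse (≈ᴹ-sym D≈D′) _ j) (leftInverse-row k∉ j)
    }
    where open KernelCoordinates K

  leftInvertible⇒kernelCoordinates : ∀ {n} {L C : Mat n n} → L · C ≈ᴹ 𝟙 → KernelCoordinates C 0
  leftInvertible⇒kernelCoordinates {L = L} LC≈𝟙 = record
    { coord           = λ ()
    ; coord-injective = λ {a} → contradiction a λ ()
    ; coord?          = λ _ → no λ ()
    ; column-zero     = λ _ ()
    ; leftInverse     = L
    ; leftInverse-row = λ _ → LC≈𝟙 _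
    }

  kernelCoordinates-⊕ : ∀ {n₁ n₂ m₁ m₂} {M : Mat n₁ n₁} {N : Mat n₂ n₂} →
                        KernelCoordinates M m₁ → KernelCoordinates N m₂ →
                        KernelCoordinates (M ⊕ N) (m₁ ℕ.+ m₂)
  kernelCoordinates-⊕ {n₁} {n₂} {m₁} {m₂} {M} {N} K K′ = record
    { coord           = coord
    ; coord-injective = injective
    ; coord?          = coord?
    ; column-zero     = column-zero
    ; leftInverse     = L₁ ⊕ L₂
    ; leftInverse-row = leftInverse-row
    }
    where
    module K  = KernelCoordinates K
    module K′ = KernelCoordinates K′
    open import Relation.Binary.Reasoning.Setoid setoid

    L₁ = K.leftInverse
    L₂ = K′.leftInverse

    coord : Fin (m₁ ℕ.+ m₂) → Fin (n₁ ℕ.+ n₂)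
    coord = Fin.join n₁ n₂ ∘ Sum.map K.coord K′.coord ∘ Fin.splitAt m₁

    coord-ˡ : ∀ a → coord (a ↑ˡ m₂) ≡ K.coord a ↑ˡ n₂
    coord-ˡ a rewrite splitAt-↑ˡ m₁ a m₂ = ≡.refl

    coord-ʳ : ∀ a → coord (m₁ ↑ʳ a) ≡ n₁ ↑ʳ K′.coord a
    coord-ʳ a rewrite splitAt-↑ʳ m₁ m₂ a = ≡.refl

    injective : ∀ {c d} → coord c ≡ coord d → c ≡ d
    injective {c} {d} eq with splitView m₁ m₂ c | splitView m₁ m₂ d
    ... | inˡ a | inˡ b = ≡.cong (_↑ˡ m₂) (K.coord-injective
      (↑ˡ-injective n₂ _ _ (≡.trans (≡.sym (coord-ˡ a)) (≡.trans eq (coord-ˡ b)))))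
    ... | inˡ a | inʳ b =
      contradiction (≡.trans (≡.sym (coord-ˡ a)) (≡.trans eq (coord-ʳ b))) (↑ˡ≢↑ʳ _ _)
    ... | inʳ a | inˡ b =
      contradiction (≡.trans (≡.sym (coord-ˡ b)) (≡.trans (≡.sym eq) (coord-ʳ a))) (↑ˡ≢↑ʳ _ _)
    ... | inʳ a | inʳ b = ≡.cong (m₁ ↑ʳ_) (K′.coord-injective
      (↑ʳ-injective n₁ _ _ (≡.trans (≡.sym (coord-ʳ a)) (≡.trans eq (coord-ʳ b)))))

    liftˡ : ∀ {k} → ∃ (λ a → K.coord a ≡ k) → ∃ λ c → coord c ≡ k ↑ˡ n₂
    liftˡ (a , ≡.refl) = a ↑ˡ m₂ , coord-ˡ a

    liftʳ : ∀ {k} → ∃ (λ a → K′.coord a ≡ k) → ∃ λ c → coord c ≡ n₁ ↑ʳ k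
    liftʳ (a , ≡.refl) = m₁ ↑ʳ a , coord-ʳ a

    lowerˡ : ∀ {k} → ∃ (λ c → coord c ≡ k ↑ˡ n₂) → ∃ λ a → K.coord a ≡ k
    lowerˡ (c , eq) with splitView m₁ m₂ c
    ... | inˡ a = a , ↑ˡ-injective n₂ _ _ (≡.trans (≡.sym (coord-ˡ a)) eq)
    ... | inʳ a = contradiction (≡.trans (≡.sym eq) (coord-ʳ a)) (↑ˡ≢↑ʳ _ _)

    lowerʳ : ∀ {k} → ∃ (λ c → coord c ≡ n₁ ↑ʳ k) → ∃ λ a → K′.coord a ≡ k
    lowerʳ (c , eq) with splitView m₁ m₂ c
    ... | inˡ a = contradiction (≡.trans (≡.sym (coord-ˡ a)) eq) (↑ˡ≢↑ʳ _ _)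
    ... | inʳ a = a , ↑ʳ-injective n₁ _ _ (≡.trans (≡.sym (coord-ʳ a)) eq)

    coord? : ∀ k → Dec (∃ λ c → coord c ≡ k)
    coord? k with splitView n₁ n₂ k
    ... | inˡ k = Dec.map′ liftˡ lowerˡ (K.coord? k)
    ... | inʳ k = Dec.map′ liftʳ lowerʳ (K′.coord? k)

    column-zero : ∀ i c → (M ⊕ N) i (coord c) ≈ 0#
    column-zero i c with splitView m₁ m₂ c | splitView n₁ n₂ i
    ... | inˡ a | inˡ i rewrite coord-ˡ a =
      trans (reflexive (⊕-ˡˡ M N i (K.coord a))) (K.column-zero i a)
    ... | inˡ a | inʳ i rewrite coord-ˡ a = reflexive (⊕-ʳˡ M N i (K.coord a))
    ... | inʳ a | inˡ i rewrite coord-ʳ a = reflexive (⊕-ˡʳ M N i (K′.coord a))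
    ... | inʳ a | inʳ i rewrite coord-ʳ a =
      trans (reflexive (⊕-ʳʳ M N i (K′.coord a))) (K′.column-zero i a)

    leftInverse-row : ∀ {k} → ¬ (∃ λ c → coord c ≡ k) →
                      ∀ j → ((L₁ ⊕ L₂) · (M ⊕ N)) k j ≈ 𝟙 k j
    leftInverse-row {k} k∉ j with splitView n₁ n₂ k
    ... | inˡ k = begin
      ((L₁ ⊕ L₂) · (M ⊕ N)) (k ↑ˡ n₂) j
        ≈⟨ ⊕-· L₁ M L₂ N _ j ⟩
      ((L₁ · M) ⊕ (L₂ · N)) (k ↑ˡ n₂) j
        ≈⟨ ⊕-cong-rowˡ _ 𝟙 (L₂ · N) 𝟙 (K.leftInverse-row (k∉ ∘ liftˡ)) j ⟩
      (𝟙 {n₁} ⊕ 𝟙 {n₂}) (k ↑ˡ n₂) j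
        ≈⟨ 𝟙-⊕ {n₁} {n₂} _ j ⟨
      𝟙 (k ↑ˡ n₂) j
        ∎
    ... | inʳ k = begin
      ((L₁ ⊕ L₂) · (M ⊕ N)) (n₁ ↑ʳ k) j
        ≈⟨ ⊕-· L₁ M L₂ N _ j ⟩
      ((L₁ · M) ⊕ (L₂ · N)) (n₁ ↑ʳ k) j
        ≈⟨ ⊕-cong-rowʳ (L₁ · M) 𝟙 _ 𝟙 (K′.leftInverse-row (k∉ ∘ liftʳ)) j ⟩
      (𝟙 {n₁} ⊕ 𝟙 {n₂}) (n₁ ↑ʳ k) j
        ≈⟨ 𝟙-⊕ {n₁} {n₂} _ j ⟨
      𝟙 (n₁ ↑ʳ k) j
        ∎

  jordan0-row : ∀ b (i : Fin b) j → jordan0 (suc b) (Fin.inject₁ i) j ≡ 𝟙 (suc i) j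
  jordan0-row b i j = ≡.cong (λ x → δ (suc x) (toℕ j)) (toℕ-inject₁ i)

  jordan0-column : ∀ b i (j : Fin b) → jordan0 (suc b) i (suc j) ≡ 𝟙 (Fin.inject₁ j) i
  jordan0-column b i j = ≡.trans (δ-suc (toℕ i) (toℕ j))
    (≡.trans (δ-sym (toℕ i) (toℕ j)) (≡.cong (λ x → δ x (toℕ i)) (≡.sym (toℕ-inject₁ j))))

  jordan0-lastRow : ∀ b i → jordan0 (suc b) (Fin.fromℕ b) i ≡ 0#
  jordan0-lastRow b i rewrite toℕ-fromℕ b = δ-≢ (ℕ.<⇒≢ (toℕ<n i) ∘ ≡.sym)

  jordan0-kernelCoordinates : ∀ b → KernelCoordinates (jordan0 (suc b)) 1
  jordan0-kernelCoordinates b = record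
    { coord           = λ _ → zero
    ; coord-injective = λ { {zero} {zero} _ → ≡.refl }
    ; coord?          = coord?
    ; column-zero     = λ _ _ → refl
    ; leftInverse     = J ᵀ
    ; leftInverse-row = leftInverse-row
    }
    where
    J = jordan0 (suc b)
    open import Relation.Binary.Reasoning.Setoid setoid

    coord? : ∀ k → Dec (∃ λ (a : Fin 1) → zero ≡ k)
    coord? zero    = yes (zero , ≡.refl)
    coord? (suc k) = no λ ()

    leftInverse-row : ∀ {k} → ¬ (∃ λ (a : Fin 1) → zero ≡ k) → ∀ j → (J ᵀ · J) k j ≈ 𝟙 k j
    leftInverse-row {zero}  0∉ j = contradiction (zero , ≡.refl) 0∉
    leftInverse-row {suc k} _  j = begin
      ∑ (λ i → J i (suc k) * J i j)
        ≈⟨ ∑-cong (λ i → reflexive (≡.cong (_* J i j) (jordan0-column b i k))) ⟩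
      ∑ (λ i → 𝟙 (Fin.inject₁ k) i * J i j)
        ≈⟨ ∑-𝟙ˡ (Fin.inject₁ k) (λ i → J i j) ⟩
      J (Fin.inject₁ k) j
        ≡⟨ jordan0-row b k j ⟩
      𝟙 (suc k) j
        ∎

  jordan0ᵀ-kernelCoordinates : ∀ b → KernelCoordinates (jordan0 (suc b) ᵀ) 1
  jordan0ᵀ-kernelCoordinates b = record
    { coord           = λ _ → Fin.fromℕ b
    ; coord-injective = λ { {zero} {zero} _ → ≡.refl }
    ; coord?          = coord?
    ; column-zero     = λ i _ → reflexive (jordan0-lastRow b i)
    ; leftInverse     = J
    ; leftInverse-row = leftInverse-row
    }
    where
    J = jordan0 (suc b)
    open import Relation.Binary.Reasoning.Setoid setoid

    coord? : ∀ k → Dec (∃ λ (a : Fin 1) → Fin.fromℕ b ≡ k)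
    coord? k with view k
    ... | ‵fromℕ     = yes (zero , ≡.refl)
    ... | ‵inject₁ k = no (fromℕ≢inject₁ ∘ proj₂)

    leftInverse-row : ∀ {k} → ¬ (∃ λ (a : Fin 1) → Fin.fromℕ b ≡ k) →
                      ∀ j → (J · J ᵀ) k j ≈ 𝟙 k j
    leftInverse-row {k} k∉ j with view k
    ... | ‵fromℕ     = contradiction (zero , ≡.refl) k∉
    ... | ‵inject₁ k = begin
      ∑ (λ i → J (Fin.inject₁ k) i * J j i)
        ≈⟨ ∑-cong (λ i → reflexive (≡.cong (_* J j i) (jordan0-row b k i))) ⟩
      ∑ (λ i → 𝟙 (suc k) i * J j i)
        ≈⟨ ∑-𝟙ˡ (suc k) (J j) ⟩
      J j (suc k)
        ≡⟨ jordan0-column b j k ⟩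
      𝟙 (Fin.inject₁ k) j
        ∎

  jordanNil-kernelCoordinates : ∀ {m} (bs : Vec ℕ m) → KernelCoordinates (jordanNil bs) m
  jordanNil-kernelCoordinates []       = leftInvertible⇒kernelCoordinates {L = 𝟘} λ ()
  jordanNil-kernelCoordinates (b ∷ bs) =
    kernelCoordinates-⊕ (jordan0-kernelCoordinates b) (jordanNil-kernelCoordinates bs)

  jordanNilᵀ-kernelCoordinates : ∀ {m} (bs : Vec ℕ m) → KernelCoordinates (jordanNil bs ᵀ) m
  jordanNilᵀ-kernelCoordinates []       = leftInvertible⇒kernelCoordinates {L = 𝟘} λ ()
  jordanNilᵀ-kernelCoordinates (b ∷ bs) =
    kernelCoordinates-resp (≈ᴹ-sym (⊕-ᵀ (jordan0 (suc b)) (jordanNil bs)))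
      (kernelCoordinates-⊕ (jordan0ᵀ-kernelCoordinates b) (jordanNilᵀ-kernelCoordinates bs))

  Annihilator : ∀ {n} → Mat n n → Mat n n → Set ℓ
  Annihilator A B = A · B ≈ᴹ 𝟘 × B · A ≈ᴹ 𝟘

  annihilator-respˡ : ∀ {n} {A A′ B : Mat n n} → A ≈ᴹ A′ → Annihilator A B → Annihilator A′ B
  annihilator-respˡ {B = B} A≈A′ (AB≈𝟘 , BA≈𝟘) =
    ≈ᴹ-trans (·-congʳ B (≈ᴹ-sym A≈A′)) AB≈𝟘 ,
    ≈ᴹ-trans (·-congˡ B (≈ᴹ-sym A≈A′)) BA≈𝟘

  annihilator-respʳ : ∀ {n} {A B B′ : Mat n n} → B ≈ᴹ B′ → Annihilator A B → Annihilator A B′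
  annihilator-respʳ {A = A} B≈B′ (AB≈𝟘 , BA≈𝟘) =
    ≈ᴹ-trans (·-congˡ A (≈ᴹ-sym B≈B′)) AB≈𝟘 ,
    ≈ᴹ-trans (·-congʳ A (≈ᴹ-sym B≈B′)) BA≈𝟘

  RowsVanishOff : ∀ {n m t} {D : Mat n n} → KernelCoordinates D m → Mat n t → Set ℓ
  RowsVanishOff K Y = ∀ {k} → ¬ (∃ λ a → KernelCoordinates.coord K a ≡ k) → ∀ j → Y k j ≈ 0#

  module _ {n m} {D : Mat n n} (K : KernelCoordinates D m) where
    open KernelCoordinates K

    ·≈𝟘⇒rowsVanishOff : ∀ {t} {Y : Mat n t} → D · Y ≈ᴹ 𝟘 → RowsVanishOff K Y
    ·≈𝟘⇒rowsVanishOff {Y = Y} DY≈𝟘 {k} k∉ j = begin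
      Y k j
        ≈⟨ ·-identityˡ Y k j ⟨
      (𝟙 · Y) k j
        ≈⟨ ·-cong-row {M = 𝟙} {leftInverse · D} Y (λ i → sym (leftInverse-row k∉ i)) j ⟩
      ((leftInverse · D) · Y) k j
        ≈⟨ ·-assoc leftInverse D Y k j ⟩
      (leftInverse · (D · Y)) k j
        ≈⟨ ·-congˡ leftInverse DY≈𝟘 k j ⟩
      (leftInverse · 𝟘) k j
        ≈⟨ ·-zeroʳ leftInverse k j ⟩
      0#
        ∎
      where open import Relation.Binary.Reasoning.Setoid setoid

    rowsVanishOff⇒·≈𝟘 : ∀ {t} {Y : Mat n t} → RowsVanishOff K Y → D · Y ≈ᴹ 𝟘
    rowsVanishOff⇒·≈𝟘 {Y = Y} Y≈0 i j = ∑-zero term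
      where
      term : ∀ k → D i k * Y k j ≈ 0#
      term k with coord? k
      ... | yes (a , ≡.refl) = trans (*-congʳ (column-zero i a)) (zeroˡ _)
      ... | no k∉            = trans (*-congˡ (Y≈0 k∉ j)) (zeroʳ _)

  module _ {n m m′} {D : Mat n n} (K : KernelCoordinates D m) (K′ : KernelCoordinates (D ᵀ) m′) where
    private
      module K  = KernelCoordinates K
      module K′ = KernelCoordinates K′

    embed : Mat m m′ → Mat n n
    embed X k j with K.coord? k | K′.coord? j
    ... | yes (a , _) | yes (b , _) = X a b
    ... | _           | _           = 0#

    extract : Mat n n → Mat m m′
    extract Y a b = Y (K.coord a) (K′.coord b)

    embed-cong : ∀ {X X′} → X ≈ᴹ X′ → embed X ≈ᴹ embed X′
    embed-cong X≈X′ k j with K.coord? k | K′.coord? j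
    ... | yes (a , _) | yes (b , _) = X≈X′ a b
    ... | yes _       | no _        = refl
    ... | no _        | _           = refl

    extract-embed : ∀ X → extract (embed X) ≈ᴹ X
    extract-embed X a b with K.coord? (K.coord a) | K′.coord? (K′.coord b)
    ... | yes (_ , e) | yes (_ , e′) = reflexive (≡.cong₂ X (K.coord-injective e) (K′.coord-injective e′))
    ... | yes _       | no b∉        = contradiction (b , ≡.refl) b∉
    ... | no a∉       | _            = contradiction (a , ≡.refl) a∉

    embed-annihilator : ∀ X → Annihilator D (embed X)
    embed-annihilator X =
      rowsVanishOff⇒·≈𝟘 K rows ,
      ·≈𝟘⇒ᵀ·ᵀ≈𝟘 {M = D ᵀ} {embed X ᵀ} (rowsVanishOff⇒·≈𝟘 K′ columns)
      where
      rows : RowsVanishOff K (embed X)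
      rows {k} k∉ j with K.coord? k | K′.coord? j
      ... | yes k∈ | _ = contradiction k∈ k∉
      ... | no _   | _ = refl

      columns : RowsVanishOff K′ (embed X ᵀ)
      columns {j} j∉ k with K.coord? k | K′.coord? j
      ... | yes _ | yes j∈ = contradiction j∈ j∉
      ... | yes _ | no _   = refl
      ... | no _  | _      = refl

    annihilator⇒embed-extract : ∀ {Y} → Annihilator D Y → Y ≈ᴹ embed (extract Y)
    annihilator⇒embed-extract {Y} (DY≈𝟘 , YD≈𝟘) k j with K.coord? k | K′.coord? j
    ... | yes (a , ≡.refl) | yes (b , ≡.refl) = refl
    ... | yes _ | no j∉ = ·≈𝟘⇒rowsVanishOff K′ (·≈𝟘⇒ᵀ·ᵀ≈𝟘 {M = Y} YD≈𝟘) j∉ k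
    ... | no k∉ | _     = ·≈𝟘⇒rowsVanishOff K DY≈𝟘 k∉ j

  conjugate : ∀ {r n} → Mat r n → Mat n r → Mat n n → Mat r r
  conjugate U V X = (U · X) · V

  module _ {r n} (U : Mat r n) (V : Mat n r) where
    conjugate-cong : ∀ {X X′} → X ≈ᴹ X′ → conjugate U V X ≈ᴹ conjugate U V X′
    conjugate-cong X≈X′ = ·-congʳ V (·-congˡ U X≈X′)

    conjugate-𝟘 : conjugate U V 𝟘 ≈ᴹ 𝟘
    conjugate-𝟘 = ≈ᴹ-trans (·-congʳ V (·-zeroʳ U)) (·-zeroˡ V)

    conjugate-· : V · U ≈ᴹ 𝟙 → ∀ X Y → conjugate U V X · conjugate U V Y ≈ᴹ conjugate U V (X · Y)
    conjugate-· VU≈𝟙 X Y = begin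
      ((U · X) · V) · ((U · Y) · V)  ≈⟨ ·-assoc (U · X) V ((U · Y) · V) ⟩
      (U · X) · (V · ((U · Y) · V))  ≈⟨ ·-congˡ (U · X) (·-congˡ V (·-assoc U Y V)) ⟩
      (U · X) · (V · (U · (Y · V)))  ≈⟨ ·-congˡ (U · X) (·-assoc V U (Y · V)) ⟨
      (U · X) · ((V · U) · (Y · V))  ≈⟨ ·-congˡ (U · X) (·-congʳ (Y · V) VU≈𝟙) ⟩
      (U · X) · (𝟙 · (Y · V))        ≈⟨ ·-congˡ (U · X) (·-identityˡ (Y · V)) ⟩
      (U · X) · (Y · V)              ≈⟨ ·-assoc (U · X) Y V ⟨
      ((U · X) · Y) · V              ≈⟨ ·-congʳ V (·-assoc U X Y) ⟩
      (U · (X · Y)) · V              ∎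
      where open import Relation.Binary.Reasoning.Setoid (matSetoid r r)

    conjugate-annihilator : V · U ≈ᴹ 𝟙 → ∀ {A B} → Annihilator A B →
                            Annihilator (conjugate U V A) (conjugate U V B)
    conjugate-annihilator VU≈𝟙 {A} {B} (AB≈𝟘 , BA≈𝟘) =
      ≈ᴹ-trans (conjugate-· VU≈𝟙 A B) (≈ᴹ-trans (conjugate-cong AB≈𝟘) conjugate-𝟘) ,
      ≈ᴹ-trans (conjugate-· VU≈𝟙 B A) (≈ᴹ-trans (conjugate-cong BA≈𝟘) conjugate-𝟘)

    conjugate-conjugate : ∀ {U′ V′} → U′ · U ≈ᴹ 𝟙 → V · V′ ≈ᴹ 𝟙 →
                          ∀ X → conjugate U′ V′ (conjugate U V X) ≈ᴹ X
    conjugate-conjugate {U′} {V′} U′U≈𝟙 VV′≈𝟙 X = begin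
      (U′ · ((U · X) · V)) · V′  ≈⟨ ·-congʳ V′ (·-assoc U′ (U · X) V) ⟨
      ((U′ · (U · X)) · V) · V′  ≈⟨ ·-assoc (U′ · (U · X)) V V′ ⟩
      (U′ · (U · X)) · (V · V′)  ≈⟨ ·-congˡ (U′ · (U · X)) VV′≈𝟙 ⟩
      (U′ · (U · X)) · 𝟙         ≈⟨ ·-identityʳ (U′ · (U · X)) ⟩
      U′ · (U · X)               ≈⟨ ·-assoc U′ U X ⟨
      (U′ · U) · X               ≈⟨ ·-congʳ X U′U≈𝟙 ⟩
      𝟙 · X                      ≈⟨ ·-identityˡ X ⟩
      X                          ∎
      where open import Relation.Binary.Reasoning.Setoid (matSetoid n n)

  record AnnihilatorBijection {n} (A : Mat n n) (m : ℕ) : Set (c ⊔ ℓ) where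
    field
      to               : Mat n n → Mat m m
      from             : Mat m m → Mat n n
      to-cong          : ∀ {B B′} → B ≈ᴹ B′ → to B ≈ᴹ to B′
      from-cong        : ∀ {X X′} → X ≈ᴹ X′ → from X ≈ᴹ from X′
      from-annihilator : ∀ X → Annihilator A (from X)
      to-from          : ∀ X → to (from X) ≈ᴹ X
      from-to          : ∀ {B} → Annihilator A B → from (to B) ≈ᴹ B

  zeroJordanBlocks⇒annihilatorBijection : ∀ {n m} {A : Mat n n} →
                                          ZeroJordanBlocks A m → AnnihilatorBijection A m
  zeroJordanBlocks⇒annihilatorBijection {n} {m} {A} Z = record
    { to               = λ B → extract K Kᵀ (conjugate Q P B)
    ; from             = λ X → conjugate P Q (embed K Kᵀ X)
    ; to-cong          = λ B≈B′ a b → conjugate-cong Q P B≈B′ _ _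
    ; from-cong        = conjugate-cong P Q ∘ embed-cong K Kᵀ
    ; from-annihilator = λ X →
        annihilator-respˡ conjugate-D≈A (conjugate-annihilator P Q QP≈1 (embed-annihilator K Kᵀ X))
    ; to-from          = λ X →
        ≈ᴹ-trans (λ a b → conjugate-conjugate P Q QP≈1 QP≈1 (embed K Kᵀ X) _ _) (extract-embed K Kᵀ X)
    ; from-to          = λ {B} B-ann → ≈ᴹ-trans
        (conjugate-cong P Q (≈ᴹ-sym (annihilator⇒embed-extract K Kᵀ
          (annihilator-respˡ similar (conjugate-annihilator Q P PQ≈1 B-ann)))))
        (conjugate-conjugate Q P PQ≈1 PQ≈1 B)
    }
    where
    open ZeroJordanBlocks Z

    D : Mat (blocksSize sizes ℕ.+ l) (blocksSize sizes ℕ.+ l)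
    D = jordanNil sizes ⊕ C

    C⁻¹ = proj₁ C-inv

    C⁻¹ᵀ·Cᵀ≈𝟙 : C⁻¹ ᵀ · C ᵀ ≈ᴹ 𝟙
    C⁻¹ᵀ·Cᵀ≈𝟙 i j = trans (sym (·-ᵀ C C⁻¹ i j))
      (trans (proj₁ (proj₂ C-inv) j i) (reflexive (δ-sym (toℕ j) (toℕ i))))

    K : KernelCoordinates D m
    K = ≡.subst (KernelCoordinates D) (ℕ.+-identityʳ m) (kernelCoordinates-⊕
      (jordanNil-kernelCoordinates sizes) (leftInvertible⇒kernelCoordinates (proj₂ (proj₂ C-inv))))

    Kᵀ : KernelCoordinates (D ᵀ) m
    Kᵀ = ≡.subst (KernelCoordinates (D ᵀ)) (ℕ.+-identityʳ m)
      (kernelCoordinates-resp (≈ᴹ-sym (⊕-ᵀ (jordanNil sizes) C)) (kernelCoordinates-⊕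
        (jordanNilᵀ-kernelCoordinates sizes) (leftInvertible⇒kernelCoordinates C⁻¹ᵀ·Cᵀ≈𝟙)))

    conjugate-D≈A : conjugate P Q D ≈ᴹ A
    conjugate-D≈A = ≈ᴹ-trans (conjugate-cong P Q (≈ᴹ-sym similar)) (conjugate-conjugate Q P PQ≈1 PQ≈1 A)

  allMats-unique : ∀ r → Unique (matSetoid r r) (allMats r)
  allMats-unique r = allFuns-unique (VecEquality.≋-setoid setoid r) r (allFuns-unique setoid r distinct)

  allMats-enumerates : ∀ r → IsEnumeration (matSetoid r r) (allMats r)
  allMats-enumerates r =
    allFuns-enumerates (VecEquality.≋-setoid setoid r) r (allFuns-enumerates setoid r complete)

  length-allMats : ∀ r → length (allMats r) ≡ order ℕ.^ (r ℕ.* r)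
  length-allMats r = ≡.trans (length-allFuns r (allFuns r elements))
    (≡.trans (≡.cong (ℕ._^ r) (length-allFuns r elements)) (ℕ.^-*-assoc order r r))

  annihilatorBijection⇒annihilatorCount : ∀ {n m} {A : Mat n n} →
                                          AnnihilatorBijection A m → annihilatorCount A ≡ order ℕ.^ (m ℕ.* m)
  annihilatorBijection⇒annihilatorCount {n} {m} {A} bij =
    ≡.trans (ℕ.≤-antisym annihilators-≤ ≤-annihilators) (length-allMats m)
    where
    open AnnihilatorBijection bij
    open SetoidMembership (matSetoid n n) using () renaming (_∈_ to _∈ₙ_)

    annihilator? = λ B → ((A · B) ≟ᴹ 𝟘) ×-dec ((B · A) ≟ᴹ 𝟘)
    annihilators = filter annihilator? (allMats n)

    ∈-annihilators⁻ : ∀ {B} → B ∈ₙ annihilators → Annihilator A B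
    ∈-annihilators⁻ B∈ =
      proj₂ (∈-filter⁻ (matSetoid n n) annihilator? annihilator-respʳ {xs = allMats n} B∈)

    annihilators-≤ : length annihilators ℕ.≤ length (allMats m)
    annihilators-≤ = length-≤-injection (matSetoid n n) (matSetoid m m) to
      (filter⁺ (matSetoid n n) annihilator? (allMats-unique n))
      (λ _ → allMats-enumerates m _)
      (λ B∈ B′∈ toB≈toB′ → ≈ᴹ-trans (≈ᴹ-sym (from-to (∈-annihilators⁻ B∈)))
        (≈ᴹ-trans (from-cong toB≈toB′) (from-to (∈-annihilators⁻ B′∈))))

    ≤-annihilators : length (allMats m) ℕ.≤ length annihilators
    ≤-annihilators = length-≤-injection (matSetoid m m) (matSetoid n n) from (allMats-unique m)
      (λ {X} _ → ∈-filter⁺ (matSetoid n n) annihilator? annihilator-respʳ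
                   (allMats-enumerates n _) (from-annihilator X))
      (λ {X} {X′} _ _ fromX≈fromX′ → ≈ᴹ-trans (≈ᴹ-sym (to-from X))
        (≈ᴹ-trans (to-cong fromX≈fromX′) (to-from X′)))

open import Data.Nat using (_^_; _*_)

lemma3p2 : ∀ {c ℓ : Level} (F : FiniteField c ℓ) (n : ℕ) (A : Matrices.Mat F n n) (m : ℕ) →
    Matrices.ZeroJordanBlocks F A m →
    Matrices.annihilatorCount F A ≡ FiniteField.order F ^ (m * m)
lemma3p2 F n A m Z =
  annihilatorBijection⇒annihilatorCount F (zeroJordanBlocks⇒annihilatorBijection F Z)
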